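{- For every closed $\lambda$-term $M$ there exists a closed term $N$ in weak $\beta\mathbf{\Omega}$ head normal form such that $M \longrightarrow^{*}_{w\beta\Omega} N$.
   Context: Untyped $\lambda$-calculus; $[N/x]U$ is capture-avoiding substitution; $\mathbf{\Omega}\equiv(\lambda x.xx)(\lambda x.xx)$; a closed term is unsolvable if no application of it to closed terms $\beta$-converts to $\lambda x.x$, solvable otherwise. Weak $\beta\mathbf{\Omega}$-reduction $\longrightarrow_{w\beta\Omega}$ is the closure under contexts of the contraction rules $(\lambda x.M)N \to [N/x]M$ (only when the redex $(\lambda x.M)N$ is closed) and $M\to\mathbf{\Omega}$ (only when $M$ is closed, unsolvable and $M\not\equiv\mathbf{\Omega}$); $\longrightarrow^{*}_{w\beta\Omega}$ is its reflexive transitive closure. A closed term is in weak $\beta\mathbf{\Omega}$ head normal form (whnf) if either it is unsolvable and is $\mathbf{\Omega}$, or it is solvable and is not of the form $\lambda x_1\dots x_n.(\lambda x.U)VM_1\cdots M_k$ with $\lambda x.U$ and $V$ closed. -}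

module Defs where

open import Data.Nat using (ℕ; zero; suc)
open import Data.Fin using (Fin; zero; suc)
open import Data.List using (List; []; _∷_)
open import Data.Product using (Σ; ∃; _×_; _,_)
open import Data.Sum using (_⊎_)
open import Relation.Nullary using (¬_)
open import Relation.Binary.PropositionalEquality using (_≡_)
open import Relation.Binary.Construct.Closure.ReflexiveTransitive using (Star)
open import Relation.Binary.Construct.Closure.Equivalence using (EqClosure)

-- Untyped λ-terms, de Bruijn, indexed by the number of free variables.
-- Term 0 = closed terms. α-equivalent terms are identified (≡ is α-equivalence).

infixl 7 _·_

data Term (n : ℕ) : Set where
  var : Fin n → Term n
  lam : Term (suc n) → Term n
  _·_ : Term n → Term n → Term n

ext : ∀ {m n} → (Fin m → Fin n) → Fin (suc m) → Fin (suc n)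
ext ρ zero    = zero
ext ρ (suc i) = suc (ρ i)

rename : ∀ {m n} → (Fin m → Fin n) → Term m → Term n
rename ρ (var i) = var (ρ i)
rename ρ (lam M) = lam (rename (ext ρ) M)
rename ρ (M · N) = rename ρ M · rename ρ N

exts : ∀ {m n} → (Fin m → Term n) → Fin (suc m) → Term (suc n)
exts σ zero    = var zero
exts σ (suc i) = rename suc (σ i)

subst : ∀ {m n} → (Fin m → Term n) → Term m → Term n
subst σ (var i) = σ i
subst σ (lam M) = lam (subst (exts σ) M)
subst σ (M · N) = subst σ M · subst σ N

sub1 : ∀ {n} → Term n → Fin (suc n) → Term n
sub1 N zero    = N
sub1 N (suc i) = var i

_[_] : ∀ {n} → Term (suc n) → Term n → Term n
M [ N ] = subst (sub1 N) M

noVar : ∀ {n} → Fin 0 → Fin n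
noVar ()

wk : ∀ {n} → Term 0 → Term n
wk = rename noVar

I : Term 0
I = lam (var zero)

ω : Term 0
ω = lam (var zero · var zero)

Ω : Term 0
Ω = ω · ω

apps : ∀ {n} → Term n → List (Term n) → Term n
apps M []       = M
apps M (N ∷ Ns) = apps (M · N) Ns

data _→β_ {n : ℕ} : Term n → Term n → Set where
  β    : ∀ {M : Term (suc n)} {N} → (lam M · N) →β (M [ N ])
  ξlam : ∀ {M M'} → M →β M' → lam M →β lam M'
  ξl   : ∀ {M M' N} → M →β M' → (M · N) →β (M' · N)
  ξr   : ∀ {M N N'} → N →β N' → (M · N) →β (M · N')

_=β_ : ∀ {n} → Term n → Term n → Set
_=β_ = EqClosure _→β_

Solvable : Term 0 → Set
Solvable M = Σ (List (Term 0)) λ Ns → apps M Ns =β I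

Unsolvable : Term 0 → Set
Unsolvable M = ¬ Solvable M

data _▷_ : Term 0 → Term 0 → Set where
  βc : ∀ (M : Term 1) (N : Term 0) → (lam M · N) ▷ (M [ N ])
  Ωc : ∀ (M : Term 0) → Unsolvable M → ¬ (M ≡ Ω) → M ▷ Ω

data _⟶wβΩ_ {n : ℕ} : Term n → Term n → Set where
  top  : ∀ {M N : Term 0} → M ▷ N → wk M ⟶wβΩ wk N
  ξlam : ∀ {M M'} → M ⟶wβΩ M' → lam M ⟶wβΩ lam M'
  ξl   : ∀ {M M' N} → M ⟶wβΩ M' → (M · N) ⟶wβΩ (M' · N)
  ξr   : ∀ {M N N'} → N ⟶wβΩ N' → (M · N) ⟶wβΩ (M · N')

_⟶*wβΩ_ : ∀ {n} → Term n → Term n → Set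
_⟶*wβΩ_ = Star _⟶wβΩ_

data SpineRedex {n : ℕ} : Term n → Set where
  base : ∀ (U : Term 1) (V : Term 0) → SpineRedex (wk (lam U) · wk V)
  arg  : ∀ {P Q} → SpineRedex P → SpineRedex (P · Q)

data HeadRedexForm {n : ℕ} : Term n → Set where
  here  : ∀ {M} → SpineRedex M → HeadRedexForm M
  under : ∀ {M} → HeadRedexForm M → HeadRedexForm (lam M)

WHNF : Term 0 → Set
WHNF M = (Unsolvable M × M ≡ Ω) ⊎ (Solvable M × ¬ HeadRedexForm M)

{-# OPTIONS --safe #-}
-- A solvable closed term M is head normalising (Wadsworth). Indeed M N₁ … Nₖ =β I gives, by
-- Church–Rosser, a reduction M N₁ … Nₖ →β* I, and standardisation rearranges it so that weak head
-- steps come first; hence the head reduction of M N₁ … Nₖ, and so that of M, terminates. Contracting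
-- the closed redex of λx₁…xₙ.(λx.U) V M₁ … Mₖ is a head step and preserves solvability, so repeating
-- it stops, at a whnf. An unsolvable term is Ω or contracts to Ω in a single Ω-step.
module Submission where

open import Defs
open import Level using (0ℓ)
open import Axiom.ExcludedMiddle using (ExcludedMiddle)
open import Data.Product using (Σ; ∃; _×_; _,_)
open import Data.Nat using (ℕ; suc)
open import Data.Fin using (Fin; zero; suc)
open import Data.Sum using (inj₁; inj₂)
open import Data.List using (List; []; _∷_)
open import Function using (_∘_; id; flip)
open import Induction.WellFounded using (Acc; acc)
open import Relation.Nullary using (¬_; yes; no)
open import Relation.Binary.PropositionalEquality as ≡ using (_≡_; _≗_; refl; sym; trans; cong; cong₂)
open import Relation.Binary.Construct.Closure.ReflexiveTransitive
  using (Star; ε; _◅_; _◅◅_; gmap; foldl; kleisliStar)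
open import Relation.Binary.Construct.Closure.Symmetric using (fwd; bwd)

private
  variable
    l m n : ℕ
    M M' N N' P Q : Term n

ext-cong : {ρ ρ' : Fin m → Fin n} → ρ ≗ ρ' → ext ρ ≗ ext ρ'
ext-cong e zero    = refl
ext-cong e (suc i) = cong suc (e i)

rename-cong : {ρ ρ' : Fin m → Fin n} → ρ ≗ ρ' → rename ρ ≗ rename ρ'
rename-cong e (var i) = cong var (e i)
rename-cong e (lam M) = cong lam (rename-cong (ext-cong e) M)
rename-cong e (M · N) = cong₂ _·_ (rename-cong e M) (rename-cong e N)

exts-cong : {σ σ' : Fin m → Term n} → σ ≗ σ' → exts σ ≗ exts σ'
exts-cong e zero    = refl
exts-cong e (suc i) = cong (rename suc) (e i)

subst-cong : {σ σ' : Fin m → Term n} → σ ≗ σ' → subst σ ≗ subst σ'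
subst-cong e (var i) = e i
subst-cong e (lam M) = cong lam (subst-cong (exts-cong e) M)
subst-cong e (M · N) = cong₂ _·_ (subst-cong e M) (subst-cong e N)

rename-id : {ρ : Fin n → Fin n} → ρ ≗ id → rename ρ ≗ id
rename-id e (var i) = cong var (e i)
rename-id e (lam M) = cong lam (rename-id (λ { zero → refl ; (suc i) → cong suc (e i) }) M)
rename-id e (M · N) = cong₂ _·_ (rename-id e M) (rename-id e N)

wk-closed : (M : Term 0) → wk M ≡ M
wk-closed = rename-id (λ ())

subst-var : (M : Term n) → subst var M ≡ M
subst-var (var i) = refl
subst-var (lam M) = cong lam (trans (subst-cong (λ { zero → refl ; (suc i) → refl }) M) (subst-var M))
subst-var (M · N) = cong₂ _·_ (subst-var M) (subst-var N)

rename-rename : (ρ : Fin m → Fin n) (ρ' : Fin l → Fin m) (M : Term l) →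
                rename ρ (rename ρ' M) ≡ rename (ρ ∘ ρ') M
rename-rename ρ ρ' (var i) = refl
rename-rename ρ ρ' (lam M) =
  cong lam (trans (rename-rename (ext ρ) (ext ρ') M) (rename-cong (λ { zero → refl ; (suc i) → refl }) M))
rename-rename ρ ρ' (M · N) = cong₂ _·_ (rename-rename ρ ρ' M) (rename-rename ρ ρ' N)

subst-rename : (σ : Fin m → Term n) (ρ : Fin l → Fin m) (M : Term l) →
               subst σ (rename ρ M) ≡ subst (σ ∘ ρ) M
subst-rename σ ρ (var i) = refl
subst-rename σ ρ (lam M) =
  cong lam (trans (subst-rename (exts σ) (ext ρ) M) (subst-cong (λ { zero → refl ; (suc i) → refl }) M))
subst-rename σ ρ (M · N) = cong₂ _·_ (subst-rename σ ρ M) (subst-rename σ ρ N)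

rename-subst : (ρ : Fin m → Fin n) (σ : Fin l → Term m) (M : Term l) →
               rename ρ (subst σ M) ≡ subst (rename ρ ∘ σ) M
rename-subst ρ σ (var i) = refl
rename-subst ρ σ (lam M) = cong lam (trans (rename-subst (ext ρ) (exts σ) M) (subst-cong e M))
  where
  e : rename (ext ρ) ∘ exts σ ≗ exts (rename ρ ∘ σ)
  e zero    = refl
  e (suc i) = trans (rename-rename (ext ρ) suc (σ i)) (sym (rename-rename suc ρ (σ i)))
rename-subst ρ σ (M · N) = cong₂ _·_ (rename-subst ρ σ M) (rename-subst ρ σ N)

subst-subst : (σ : Fin m → Term n) (τ : Fin l → Term m) (M : Term l) →
              subst σ (subst τ M) ≡ subst (subst σ ∘ τ) M
subst-subst σ τ (var i) = refl
subst-subst σ τ (lam M) = cong lam (trans (subst-subst (exts σ) (exts τ) M) (subst-cong e M))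
  where
  e : subst (exts σ) ∘ exts τ ≗ exts (subst σ ∘ τ)
  e zero    = refl
  e (suc i) = trans (subst-rename (exts σ) suc (τ i)) (sym (rename-subst suc σ (τ i)))
subst-subst σ τ (M · N) = cong₂ _·_ (subst-subst σ τ M) (subst-subst σ τ N)

subst-[] : (σ : Fin m → Term n) (M : Term (suc m)) (N : Term m) →
           subst σ (M [ N ]) ≡ subst (exts σ) M [ subst σ N ]
subst-[] σ M N = begin
  subst σ (M [ N ])                             ≡⟨ subst-subst σ (sub1 N) M ⟩
  subst (subst σ ∘ sub1 N) M                    ≡⟨ subst-cong e M ⟨
  subst (subst (sub1 (subst σ N)) ∘ exts σ) M   ≡⟨ subst-subst (sub1 (subst σ N)) (exts σ) M ⟨
  subst (exts σ) M [ subst σ N ]                ∎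
  where
  open ≡.≡-Reasoning
  e : subst (sub1 (subst σ N)) ∘ exts σ ≗ subst σ ∘ sub1 N
  e zero    = refl
  e (suc i) = trans (subst-rename (sub1 (subst σ N)) suc (σ i)) (subst-var (σ i))

rename-[] : (ρ : Fin m → Fin n) (M : Term (suc m)) (N : Term m) →
            rename ρ (M [ N ]) ≡ rename (ext ρ) M [ rename ρ N ]
rename-[] ρ M N = begin
  rename ρ (M [ N ])                            ≡⟨ rename-subst ρ (sub1 N) M ⟩
  subst (rename ρ ∘ sub1 N) M                   ≡⟨ subst-cong e M ⟨
  subst (sub1 (rename ρ N) ∘ ext ρ) M           ≡⟨ subst-rename (sub1 (rename ρ N)) (ext ρ) M ⟨
  rename (ext ρ) M [ rename ρ N ]               ∎
  where
  open ≡.≡-Reasoning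
  e : sub1 (rename ρ N) ∘ ext ρ ≗ rename ρ ∘ sub1 N
  e zero    = refl
  e (suc i) = refl

infix 4 _⇒_ _⇒*_ _→β*_

data _⇒_ {n : ℕ} : Term n → Term n → Set where
  pvar : ∀ {i} → var i ⇒ var i
  plam : M ⇒ M' → lam M ⇒ lam M'
  papp : M ⇒ M' → N ⇒ N' → M · N ⇒ M' · N'
  pβ   : M ⇒ M' → N ⇒ N' → lam M · N ⇒ M' [ N' ]

_⇒*_ : Term n → Term n → Set
_⇒*_ = Star _⇒_

_→β*_ : Term n → Term n → Set
_→β*_ = Star _→β_

⇒-refl : (M : Term n) → M ⇒ M
⇒-refl (var i) = pvar
⇒-refl (lam M) = plam (⇒-refl M)
⇒-refl (M · N) = papp (⇒-refl M) (⇒-refl N)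

⇒-rename : (ρ : Fin m → Fin n) → M ⇒ M' → rename ρ M ⇒ rename ρ M'
⇒-rename ρ pvar       = pvar
⇒-rename ρ (plam p)   = plam (⇒-rename (ext ρ) p)
⇒-rename ρ (papp p q) = papp (⇒-rename ρ p) (⇒-rename ρ q)
⇒-rename ρ (pβ {M' = M'} {N' = N'} p q)
  rewrite rename-[] ρ M' N' = pβ (⇒-rename (ext ρ) p) (⇒-rename ρ q)

⇒-exts : {σ τ : Fin m → Term n} → (∀ i → σ i ⇒ τ i) → ∀ i → exts σ i ⇒ exts τ i
⇒-exts e zero    = pvar
⇒-exts e (suc i) = ⇒-rename suc (e i)

⇒-subst : {σ τ : Fin m → Term n} → (∀ i → σ i ⇒ τ i) → M ⇒ M' → subst σ M ⇒ subst τ M'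
⇒-subst e pvar       = e _
⇒-subst e (plam p)   = plam (⇒-subst (⇒-exts e) p)
⇒-subst e (papp p q) = papp (⇒-subst e p) (⇒-subst e q)
⇒-subst {τ = τ} e (pβ {M' = M'} {N' = N'} p q)
  rewrite subst-[] τ M' N' = pβ (⇒-subst (⇒-exts e) p) (⇒-subst e q)

⇒-[] : M ⇒ M' → N ⇒ N' → M [ N ] ⇒ M' [ N' ]
⇒-[] p q = ⇒-subst (λ { zero → q ; (suc i) → pvar }) p

develop : Term n → Term n
develop (var i)         = var i
develop (lam M)         = lam (develop M)
develop (lam M · N)     = develop M [ develop N ]
develop (var i · N)     = var i · develop N
develop ((M · M') · N)  = develop (M · M') · develop N

⇒-triangle : M ⇒ N → N ⇒ develop M
⇒-triangle pvar                 = pvar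
⇒-triangle (plam p)             = plam (⇒-triangle p)
⇒-triangle (papp (plam p) q)    = pβ (⇒-triangle p) (⇒-triangle q)
⇒-triangle (papp pvar q)        = papp pvar (⇒-triangle q)
⇒-triangle (papp p@(papp _ _) q) = papp (⇒-triangle p) (⇒-triangle q)
⇒-triangle (papp p@(pβ _ _) q)   = papp (⇒-triangle p) (⇒-triangle q)
⇒-triangle (pβ p q)             = ⇒-[] (⇒-triangle p) (⇒-triangle q)

strip : M ⇒ N → M ⇒* N' → ∃ λ R → N ⇒* R × N' ⇒ R
strip {N = N} p ε = N , ε , p
strip p (q ◅ qs) with strip (⇒-triangle q) qs
... | R , N⇒*R , N'⇒R = R , ⇒-triangle p ◅ N⇒*R , N'⇒R

→β⊆⇒ : M →β N → M ⇒ N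
→β⊆⇒ (β {M} {N}) = pβ (⇒-refl M) (⇒-refl N)
→β⊆⇒ (ξlam s)    = plam (→β⊆⇒ s)
→β⊆⇒ (ξl {N = N} s) = papp (→β⊆⇒ s) (⇒-refl N)
→β⊆⇒ (ξr {M = M} s) = papp (⇒-refl M) (→β⊆⇒ s)

church-rosser : P =β Q → ∃ λ R → P ⇒* R × Q ⇒* R
church-rosser {P = P} ε = P , ε , ε
church-rosser (fwd s ◅ P=βQ) with church-rosser P=βQ
... | R , P'⇒*R , Q⇒*R = R , →β⊆⇒ s ◅ P'⇒*R , Q⇒*R
church-rosser (bwd s ◅ P=βQ) with church-rosser P=βQ
... | R , P'⇒*R , Q⇒*R with strip (→β⊆⇒ s) P'⇒*R
... | S , P⇒*S , R⇒S = S , P⇒*S , Q⇒*R ◅◅ R⇒S ◅ ε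

⇒⊆→β* : M ⇒ N → M →β* N
⇒⊆→β* pvar       = ε
⇒⊆→β* (plam p)   = gmap lam ξlam (⇒⊆→β* p)
⇒⊆→β* (papp p q) = gmap (_· _) ξl (⇒⊆→β* p) ◅◅ gmap (_ ·_) ξr (⇒⊆→β* q)
⇒⊆→β* (pβ p q)   =
  gmap (λ X → lam X · _) (λ s → ξl (ξlam s)) (⇒⊆→β* p) ◅◅ gmap (_ ·_) ξr (⇒⊆→β* q) ◅◅ β ◅ ε

I-⇒*-inv : I ⇒* P → P ≡ I
I-⇒*-inv ε                 = refl
I-⇒*-inv (plam pvar ◅ I⇒*P) = I-⇒*-inv I⇒*P

=β-I⇒→β*-I : P =β I → P →β* I
=β-I⇒→β*-I P=βI with church-rosser P=βI
... | R , P⇒*R , I⇒*R with I-⇒*-inv I⇒*R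
... | refl = kleisliStar id ⇒⊆→β* P⇒*R

infix 4 _→w_ _→w*_ _→ₛ_ _→h_

data _→w_ {n : ℕ} : Term n → Term n → Set where
  wβ   : lam M · N →w M [ N ]
  wapp : M →w M' → M · N →w M' · N

_→w*_ : Term n → Term n → Set
_→w*_ = Star _→w_

→w-rename : (ρ : Fin m → Fin n) → M →w M' → rename ρ M →w rename ρ M'
→w-rename ρ (wβ {M} {N}) rewrite rename-[] ρ M N = wβ
→w-rename ρ (wapp s)                            = wapp (→w-rename ρ s)

→w-subst : (σ : Fin m → Term n) → M →w M' → subst σ M →w subst σ M'
→w-subst σ (wβ {M} {N}) rewrite subst-[] σ M N = wβ
→w-subst σ (wapp s)                           = wapp (→w-subst σ s)

→w-deterministic : M →w N → M →w N' → N ≡ N'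
→w-deterministic wβ       wβ       = refl
→w-deterministic (wapp s) (wapp t) = cong (_· _) (→w-deterministic s t)

-- Takahashi's characterisation of standard reduction: weak head reduce to a term of the
-- same outermost shape as the target, then reduce its components in the same way.
data _→ₛ_ {n : ℕ} : Term n → Term n → Set where
  svar : ∀ {i} → M →w* var i → M →ₛ var i
  slam : M →w* lam P → P →ₛ N → M →ₛ lam N
  sapp : M →w* P · Q → P →ₛ N → Q →ₛ N' → M →ₛ N · N'

→ₛ-expand : M →w* M' → M' →ₛ N → M →ₛ N
→ₛ-expand r (svar r')     = svar (r ◅◅ r')
→ₛ-expand r (slam r' p)   = slam (r ◅◅ r') p
→ₛ-expand r (sapp r' p q) = sapp (r ◅◅ r') p q

→ₛ-refl : M →ₛ M
→ₛ-refl {M = var i} = svar ε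
→ₛ-refl {M = lam M} = slam ε →ₛ-refl
→ₛ-refl {M = M · N} = sapp ε →ₛ-refl →ₛ-refl

→ₛ-rename : (ρ : Fin m → Fin n) → M →ₛ N → rename ρ M →ₛ rename ρ N
→ₛ-rename ρ (svar r)     = svar (gmap (rename ρ) (→w-rename ρ) r)
→ₛ-rename ρ (slam r p)   = slam (gmap (rename ρ) (→w-rename ρ) r) (→ₛ-rename (ext ρ) p)
→ₛ-rename ρ (sapp r p q) = sapp (gmap (rename ρ) (→w-rename ρ) r) (→ₛ-rename ρ p) (→ₛ-rename ρ q)

→ₛ-exts : {σ τ : Fin m → Term n} → (∀ i → σ i →ₛ τ i) → ∀ i → exts σ i →ₛ exts τ i
→ₛ-exts e zero    = svar ε
→ₛ-exts e (suc i) = →ₛ-rename suc (e i)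

→ₛ-subst : {σ τ : Fin m → Term n} → (∀ i → σ i →ₛ τ i) → M →ₛ N → subst σ M →ₛ subst τ N
→ₛ-subst {σ = σ} e (svar r)     = →ₛ-expand (gmap (subst σ) (→w-subst σ) r) (e _)
→ₛ-subst {σ = σ} e (slam r p)   = slam (gmap (subst σ) (→w-subst σ) r) (→ₛ-subst (→ₛ-exts e) p)
→ₛ-subst {σ = σ} e (sapp r p q) = sapp (gmap (subst σ) (→w-subst σ) r) (→ₛ-subst e p) (→ₛ-subst e q)

→ₛ-[] : M →ₛ M' → N →ₛ N' → M [ N ] →ₛ M' [ N' ]
→ₛ-[] p q = →ₛ-subst (λ { zero → q ; (suc i) → svar ε }) p

-- The λ of a β-redex in the target is reached by weak head reduction, so contracting the redex
-- is one more weak head step.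
→ₛ-→β : M →ₛ N → N →β N' → M →ₛ N'
→ₛ-→β (slam r p)              (ξlam s) = slam r (→ₛ-→β p s)
→ₛ-→β (sapp r p q)            (ξl s)   = sapp r (→ₛ-→β p s) q
→ₛ-→β (sapp r p q)            (ξr s)   = sapp r p (→ₛ-→β q s)
→ₛ-→β (sapp r (slam r' p) q)  β        = →ₛ-expand (r ◅◅ gmap (_· _) wapp r' ◅◅ wβ ◅ ε) (→ₛ-[] p q)

→β*⊆→ₛ : M →β* N → M →ₛ N
→β*⊆→ₛ = foldl _→ₛ_ →ₛ-→β →ₛ-refl

data _→h_ {n : ℕ} : Term n → Term n → Set where
  hw   : M →w M' → M →h M'
  hlam : M →h M' → lam M →h lam M'

→h-subst : (σ : Fin m → Term n) → M →h M' → subst σ M →h subst σ M'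
→h-subst σ (hw s)   = hw (→w-subst σ s)
→h-subst σ (hlam s) = hlam (→h-subst (exts σ) s)

→w-→h-deterministic : M →w N → M →h N' → N ≡ N'
→w-→h-deterministic s (hw t) = →w-deterministic s t

HeadNormalising : Term n → Set
HeadNormalising = Acc (flip _→h_)

HeadNormalising-var : ∀ {i : Fin n} → HeadNormalising (var i)
HeadNormalising-var = acc λ { (hw ()) }

HeadNormalising-lam : HeadNormalising M → HeadNormalising (lam M)
HeadNormalising-lam (acc rs) = acc λ { (hlam s) → HeadNormalising-lam (rs s) }

HeadNormalising-expand : M →w* M' → HeadNormalising M' → HeadNormalising M
HeadNormalising-expand ε       hn = hn
HeadNormalising-expand (s ◅ r) hn =
  acc λ t → ≡.subst HeadNormalising (→w-→h-deterministic s t) (HeadNormalising-expand r hn)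

HeadNormalising-subst⁻ : (σ : Fin m → Term n) → HeadNormalising (subst σ M) → HeadNormalising M
HeadNormalising-subst⁻ σ (acc rs) = acc λ s → HeadNormalising-subst⁻ σ (rs (→h-subst σ s))

HeadNormalising-app⁻ : HeadNormalising (M · N) → HeadNormalising M
HeadNormalising-app⁻ {M = var i}   _        = HeadNormalising-var
HeadNormalising-app⁻ {M = lam M}   (acc rs) = HeadNormalising-lam (HeadNormalising-subst⁻ _ (rs (hw wβ)))
HeadNormalising-app⁻ {M = M₁ · M₂} (acc rs) = acc λ { (hw s) → HeadNormalising-app⁻ (rs (hw (wapp s))) }

HeadNormalising-apps⁻ : (Ns : List (Term n)) → HeadNormalising (apps M Ns) → HeadNormalising M
HeadNormalising-apps⁻ []       hn = hn
HeadNormalising-apps⁻ (N ∷ Ns) hn = HeadNormalising-app⁻ (HeadNormalising-apps⁻ Ns hn)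

→ₛ-I⇒HeadNormalising : M →ₛ I → HeadNormalising M
→ₛ-I⇒HeadNormalising (slam r (svar r')) =
  HeadNormalising-expand r (HeadNormalising-lam (HeadNormalising-expand r' HeadNormalising-var))

solvable⇒HeadNormalising : Solvable M → HeadNormalising M
solvable⇒HeadNormalising (Ns , MNs=βI) =
  HeadNormalising-apps⁻ Ns (→ₛ-I⇒HeadNormalising (→β*⊆→ₛ (=β-I⇒→β*-I MNs=βI)))

Ω-not-HeadNormalising : ¬ HeadNormalising Ω
Ω-not-HeadNormalising (acc rs) = Ω-not-HeadNormalising (rs (hw wβ))

Ω-unsolvable : Unsolvable Ω
Ω-unsolvable = Ω-not-HeadNormalising ∘ solvable⇒HeadNormalising

→w⊆→β : M →w N → M →β N
→w⊆→β wβ       = β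
→w⊆→β (wapp s) = ξl (→w⊆→β s)

→h⊆→β : M →h N → M →β N
→h⊆→β (hw s)   = →w⊆→β s
→h⊆→β (hlam s) = ξlam (→h⊆→β s)

apps-→β : M →β N → (Ns : List (Term n)) → apps M Ns →β apps N Ns
apps-→β s []       = s
apps-→β s (N ∷ Ns) = apps-→β (ξl s) Ns

solvable-→β : {M N : Term 0} → Solvable M → M →β N → Solvable N
solvable-→β (Ns , MNs=βI) s = Ns , bwd (apps-→β s Ns) ◅ MNs=βI

SpineRedex-step : SpineRedex M → ∃ λ M' → M ⟶wβΩ M' × M →w M'
SpineRedex-step (base U V) = wk (U [ V ]) , top (βc U V) , →w-rename noVar wβ
SpineRedex-step (arg r) with SpineRedex-step r
... | M' , βΩ , w = M' · _ , ξl βΩ , wapp w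

HeadRedexForm-step : HeadRedexForm M → ∃ λ M' → M ⟶wβΩ M' × M →h M'
HeadRedexForm-step (here r) with SpineRedex-step r
... | M' , βΩ , w = M' , βΩ , hw w
HeadRedexForm-step (under r) with HeadRedexForm-step r
... | M' , βΩ , h = lam M' , ξlam βΩ , hlam h

ReachesWHNF : Term 0 → Set
ReachesWHNF M = Σ (Term 0) λ N → WHNF N × M ⟶*wβΩ N

ReachesWHNF-◅ : {M M' : Term 0} → M ⟶wβΩ M' → ReachesWHNF M' → ReachesWHNF M
ReachesWHNF-◅ s (N , whnf , r) = N , whnf , s ◅ r

solvable⇒ReachesWHNF : ExcludedMiddle 0ℓ → {M : Term 0} →
                       Solvable M → HeadNormalising M → ReachesWHNF M
solvable⇒ReachesWHNF em {M} sol (acc rs) with em {HeadRedexForm M}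
... | no ¬hrf = M , inj₂ (sol , ¬hrf) , ε
... | yes hrf with HeadRedexForm-step hrf
... | M' , βΩ , h = ReachesWHNF-◅ βΩ (solvable⇒ReachesWHNF em (solvable-→β sol (→h⊆→β h)) (rs h))

unsolvable⇒ReachesWHNF : ExcludedMiddle 0ℓ → {M : Term 0} → Unsolvable M → ReachesWHNF M
unsolvable⇒ReachesWHNF em {M} uns with em {M ≡ Ω}
... | yes M≡Ω = M , inj₁ (uns , M≡Ω) , ε
... | no M≢Ω  =
  Ω , inj₁ (Ω-unsolvable , refl) , ≡.subst (_⟶wβΩ Ω) (wk-closed M) (top (Ωc M uns M≢Ω)) ◅ ε

theorem7p1 : ExcludedMiddle 0ℓ → (M : Term 0) → Σ (Term 0) λ N → WHNF N × M ⟶*wβΩ N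
theorem7p1 em M with em {Solvable M}
... | yes sol = solvable⇒ReachesWHNF em sol (solvable⇒HeadNormalising sol)
... | no uns  = unsolvable⇒ReachesWHNF em uns
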